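{- Let $k$ and $w$ be positive integers and let $A$ be the adjacency matrix of a regular tournament of order $2k+1$. Let $B$ be the $2w\times 2w$ block matrix (blocks of order $2k+1$) each of whose block rows is $(A, A^T, A, A^T,\dots, A, A^T)$ (i.e. block column $j$ is $A$ for $j$ odd and $A^T$ for $j$ even), and let $C$ be the $2w\times 2w$ block matrix whose block row $i$ consists entirely of blocks $A$ if $i$ is odd and entirely of blocks $A^T$ if $i$ is even. Then $B$ and $C$ are adjacency matrices of directed strongly regular graphs with parameters $((4k+2)w,\,2kw,\,kw,\,(k-1)w,\,kw)$.
   Context: A tournament is a directed graph without loops in which for every pair of distinct vertices $x,y$ exactly one of the arcs $x\to y$, $y\to x$ is present; its $0/1$ adjacency matrix $A$ satisfies $A+A^T=J-I$. It is regular if all out-degrees are equal. A directed strongly regular graph with parameters $(n,k,t,\lambda,\mu)$ is a directed graph on $n$ vertices (no loops, no multiple arcs) whose $0/1$ adjacency matrix $M$ satisfies $M^2=tI+\lambda M+\mu(J-I-M)$ and $MJ=JM=kJ$, where $I$ is the identity and $J$ the all-ones matrix of order $n$. -}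

module Defs where

open import Data.Nat as ℕ using (ℕ; zero; suc)
open import Data.Integer as ℤ using (ℤ; +_; _+_; _*_; _-_)
open import Data.Fin as Fin using (Fin; toℕ; remQuot)
open import Data.Product using (_×_; _,_; proj₁; proj₂)
open import Data.Sum using (_⊎_)
open import Relation.Binary.PropositionalEquality using (_≡_)
open import Relation.Nullary using (¬_)
open import Relation.Nullary.Decidable using (does)
open import Data.Bool using (Bool; true; false; if_then_else_)

Mat : ℕ → Set
Mat n = Fin n → Fin n → ℤ

sumFin : ∀ {n} → (Fin n → ℤ) → ℤ
sumFin {zero}  f = + 0
sumFin {suc n} f = f Fin.zero + sumFin (λ i → f (Fin.suc i))

_⊗_ : ∀ {n} → Mat n → Mat n → Mat n
(M ⊗ N) i j = sumFin (λ l → M i l * N l j)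

transpose : ∀ {n} → Mat n → Mat n
transpose M i j = M j i

I : ∀ {n} → Mat n
I i j = if does (i Fin.≟ j) then + 1 else + 0

J : ∀ {n} → Mat n
J i j = + 1

ZeroOne : ∀ {n} → Mat n → Set
ZeroOne M = ∀ i j → (M i j ≡ + 0) ⊎ (M i j ≡ + 1)

IsTournament : ∀ {n} → Mat n → Set
IsTournament A = ZeroOne A × (∀ i j → A i j + A j i ≡ J i j - I i j)

IsRegular : ∀ {n} → Mat n → Set
IsRegular A = ∀ i j → sumFin (A i) ≡ sumFin (A j)

IsDSRG : ∀ {N} → Mat N → (n k t λ' μ : ℕ) → Set
IsDSRG {N} M n k t λ' μ =
  N ≡ n
  × ZeroOne M
  × (∀ i → M i i ≡ + 0)
  × (∀ i j → (M ⊗ M) i j ≡ + t * I i j + + λ' * M i j + + μ * (J i j - I i j - M i j))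
  × (∀ i j → (M ⊗ J) i j ≡ + k * J i j)
  × (∀ i j → (J ⊗ M) i j ≡ + k * J i j)

isEven : ℕ → Bool
isEven zero = true
isEven (suc zero) = false
isEven (suc (suc n)) = isEven n

-- Block matrix with (2w)×(2w) blocks of order m; index x ↦ (block, inner)
-- with x = block * m + inner (blocks 0-indexed).
blockMat : ∀ w m → (Fin (2 ℕ.* w) → Fin (2 ℕ.* w) → Mat m) → Mat (2 ℕ.* w ℕ.* m)
blockMat w m F x y with remQuot m x | remQuot m y
... | (i , a) | (j , b) = F i j a b

-- B: block column j (1-indexed) is A if j odd, Aᵀ if j even;
-- 0-indexed: A if toℕ j is even, Aᵀ otherwise.
matB : ∀ w m → Mat m → Mat (2 ℕ.* w ℕ.* m)
matB w m A = blockMat w m (λ i j → if isEven (toℕ j) then A else transpose A)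

-- C: block row i (1-indexed) is all A if i odd, all Aᵀ if i even.
matC : ∀ w m → Mat m → Mat (2 ℕ.* w ℕ.* m)
matC w m A = blockMat w m (λ i j → if isEven (toℕ i) then A else transpose A)

-- For a tournament A of order n, A + Aᵀ = J − I gives (A + Aᵀ) Y = JY − Y for every
-- matrix Y. If A is regular of order 2K + 1, every row and column of A and Aᵀ sums
-- to K, so JY = KJ for Y ∈ {A, Aᵀ}. In B², block (i, j) is Σₗ Xₗ Yⱼ where Xₗ runs
-- through A, Aᵀ, A, Aᵀ, … (w pairs) and Yⱼ is block (i, j) of B; hence it equals
-- w (A + Aᵀ) Yⱼ = w (KJ − Yⱼ). For C the same happens with the alternation on the
-- right. So M² = w (KJ − M) for M ∈ {B, C}, which is the DSRG equation with
-- t = μ = Kw and λ = (K − 1) w.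
module Submission where

open import Data.Bool using (Bool; true; false; if_then_else_)
open import Data.Fin as Fin using (Fin; zero; suc; toℕ; combine; quotient; remainder; _↑ˡ_; _↑ʳ_)
open import Data.Fin.Properties using (remQuot-combine)
open import Data.Integer using (ℤ; +_; _+_; _*_; _-_)
open import Data.Integer.Properties
  using (+-commutativeSemigroup; +-identityˡ; +-identityʳ; +-assoc; *-identityˡ; *-identityʳ;
         *-zeroˡ; *-zeroʳ; *-distribˡ-+; *-distribʳ-+; *-cancelˡ-≡; suc-*; pos-*; pos-+)
open import Data.Integer.Tactic.RingSolver using (solve-∀)
open import Algebra.Properties.CommutativeSemigroup +-commutativeSemigroup
  using (interchange)
open import Data.Nat as ℕ using (ℕ; zero; suc)
import Data.Nat.Properties as ℕ
import Data.Nat.Tactic.RingSolver as ℕ-Solver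
open import Data.Product using (_×_; _,_; proj₁; proj₂)
open import Data.Sum using (inj₁; inj₂)
open import Relation.Nullary using (yes; no)
open import Relation.Binary.PropositionalEquality
  using (_≡_; refl; sym; trans; cong; cong₂; module ≡-Reasoning)

open import Defs

open ≡-Reasoning

sumFin-cong : ∀ {n} {f g : Fin n → ℤ} → (∀ i → f i ≡ g i) → sumFin f ≡ sumFin g
sumFin-cong {zero}  f≗g = refl
sumFin-cong {suc n} f≗g = cong₂ _+_ (f≗g zero) (sumFin-cong (λ i → f≗g (suc i)))

sumFin-+ : ∀ {n} (f g : Fin n → ℤ) → sumFin (λ i → f i + g i) ≡ sumFin f + sumFin g
sumFin-+ {zero}  f g = refl
sumFin-+ {suc n} f g = trans (cong (_+_ (f zero + g zero)) (sumFin-+ (λ i → f (suc i)) (λ i → g (suc i))))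
                             (interchange (f zero) (g zero) _ _)

sumFin-- : ∀ {n} (f g : Fin n → ℤ) → sumFin (λ i → f i - g i) ≡ sumFin f - sumFin g
sumFin-- {zero}  f g = refl
sumFin-- {suc n} f g = trans (cong (_+_ (f zero - g zero)) (sumFin-- (λ i → f (suc i)) (λ i → g (suc i))))
                             (regroup (f zero) (g zero) _ _)
  where
  regroup : ∀ a b c d → (a - b) + (c - d) ≡ (a + c) - (b + d)
  regroup = solve-∀

sumFin-const : ∀ n (c : ℤ) → sumFin {n} (λ _ → c) ≡ + n * c
sumFin-const zero    c = sym (*-zeroˡ c)
sumFin-const (suc n) c = trans (cong (_+_ c) (sumFin-const n c)) (sym (suc-* (+ n) c))

sumFin-comm : ∀ {m n} (f : Fin m → Fin n → ℤ) →
              sumFin (λ i → sumFin (f i)) ≡ sumFin (λ j → sumFin (λ i → f i j))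
sumFin-comm {zero}  {n} f = sym (trans (sumFin-const n (+ 0)) (*-zeroʳ (+ n)))
sumFin-comm {suc m} {n} f = trans (cong (_+_ (sumFin (f zero))) (sumFin-comm (λ i → f (suc i))))
                                  (sym (sumFin-+ (f zero) _))

sumFin-↑ : ∀ m n (f : Fin (m ℕ.+ n) → ℤ) →
           sumFin f ≡ sumFin (λ i → f (i ↑ˡ n)) + sumFin (λ i → f (m ↑ʳ i))
sumFin-↑ zero    n f = sym (+-identityˡ _)
sumFin-↑ (suc m) n f = trans (cong (_+_ (f zero)) (sumFin-↑ m n (λ i → f (suc i))))
                             (sym (+-assoc (f zero) _ _))

sumFin-combine : ∀ m n (f : Fin (m ℕ.* n) → ℤ) →
                 sumFin f ≡ sumFin {m} (λ i → sumFin {n} (λ a → f (combine i a)))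
sumFin-combine zero    n f = refl
sumFin-combine (suc m) n f = trans (sumFin-↑ n (m ℕ.* n) f)
                                   (cong (_+_ (sumFin (λ a → f (a ↑ˡ m ℕ.* n)))) (sumFin-combine m n (λ x → f (n ↑ʳ x))))

sumFin-alternating : ∀ w (f : Bool → ℤ) →
                     sumFin {2 ℕ.* w} (λ l → f (isEven (toℕ l))) ≡ + w * (f true + f false)
sumFin-alternating zero    f = sym (*-zeroˡ (f true + f false))
sumFin-alternating (suc w) f rewrite ℕ.+-suc w (w ℕ.+ 0) =
  trans (cong (λ s → f true + (f false + s)) (sumFin-alternating w f)) (regroup (f true) (f false) (+ w))
  where
  regroup : ∀ x y v → x + (y + v * (x + y)) ≡ (+ 1 + v) * (x + y)
  regroup = solve-∀

I-suc : ∀ {n} (a b : Fin n) → I (suc a) (suc b) ≡ I a b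
I-suc a b with a Fin.≟ b
... | yes _ = refl
... | no _  = refl

I-sym : ∀ {n} (a b : Fin n) → I a b ≡ I b a
I-sym zero    zero    = refl
I-sym zero    (suc b) = refl
I-sym (suc a) zero    = refl
I-sym (suc a) (suc b) = trans (I-suc a b) (trans (I-sym a b) (sym (I-suc b a)))

I-diag : ∀ {n} (a : Fin n) → I a a ≡ + 1
I-diag zero    = refl
I-diag (suc a) = trans (I-suc a a) (I-diag a)

sumFin-I-* : ∀ {n} (a : Fin n) (g : Fin n → ℤ) → sumFin (λ c → I a c * g c) ≡ g a
sumFin-I-* {suc n} zero g = begin
  + 1 * g zero + sumFin (λ c → + 0 * g (suc c))  ≡⟨ cong₂ _+_ (*-identityˡ (g zero)) (sumFin-cong (λ c → *-zeroˡ (g (suc c)))) ⟩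
  g zero + sumFin {n} (λ _ → + 0)               ≡⟨ cong (_+_ (g zero)) (trans (sumFin-const n (+ 0)) (*-zeroʳ (+ n))) ⟩
  g zero + + 0                                  ≡⟨ +-identityʳ (g zero) ⟩
  g zero                                        ∎
sumFin-I-* {suc n} (suc a) g = begin
  + 0 * g zero + sumFin (λ c → I (suc a) (suc c) * g (suc c))  ≡⟨ cong₂ _+_ (*-zeroˡ (g zero)) (sumFin-cong (λ c → cong (_* g (suc c)) (I-suc a c))) ⟩
  + 0 + sumFin (λ c → I a c * g (suc c))                       ≡⟨ +-identityˡ _ ⟩
  sumFin (λ c → I a c * g (suc c))                             ≡⟨ sumFin-I-* a (λ c → g (suc c)) ⟩
  g (suc a)                                                    ∎

sumFin-I : ∀ {n} (a : Fin n) → sumFin (I a) ≡ + 1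
sumFin-I a = trans (sumFin-cong (λ c → sym (*-identityʳ (I a c)))) (sumFin-I-* a (λ _ → + 1))

⊗-J : ∀ {n} (M : Mat n) x y → (M ⊗ J) x y ≡ sumFin (M x)
⊗-J M x y = sumFin-cong (λ z → *-identityʳ (M x z))

J-⊗ : ∀ {n} (M : Mat n) x y → (J ⊗ M) x y ≡ sumFin (λ z → M z y)
J-⊗ M x y = sumFin-cong (λ z → *-identityˡ (M z y))

module Tournament {n} {A : Mat n} (tour : IsTournament A) where

  private
    A+Aᵀ≡J-I : ∀ a b → A a b + A b a ≡ J a b - I a b
    A+Aᵀ≡J-I = proj₂ tour

  diagonal : ∀ a → A a a ≡ + 0
  diagonal a with proj₁ tour a a
  ... | inj₁ Aaa≡0 = Aaa≡0
  ... | inj₂ Aaa≡1 with trans (cong₂ _+_ (sym Aaa≡1) (sym Aaa≡1)) (trans (A+Aᵀ≡J-I a a) (cong (+ 1 -_) (I-diag a)))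
  ... | ()

  rowSum+colSum : ∀ a → sumFin (A a) + sumFin (λ b → A b a) ≡ + n - + 1
  rowSum+colSum a = begin
    sumFin (A a) + sumFin (λ b → A b a)    ≡⟨ sym (sumFin-+ (A a) (λ b → A b a)) ⟩
    sumFin (λ b → A a b + A b a)           ≡⟨ sumFin-cong (A+Aᵀ≡J-I a) ⟩
    sumFin (λ b → J a b - I a b)           ≡⟨ sumFin-- (J a) (I a) ⟩
    sumFin {n} (λ _ → + 1) - sumFin (I a)  ≡⟨ cong₂ _-_ (trans (sumFin-const n (+ 1)) (*-identityʳ (+ n))) (sumFin-I a) ⟩
    + n - + 1                              ∎

  regular⇒rowSum : IsRegular A → ∀ a → + n * (+ 2 * sumFin (A a)) ≡ + n * (+ n - + 1)
  regular⇒rowSum reg a = begin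
    + n * (+ 2 * r)                                     ≡⟨ double (+ n) r ⟩
    + n * r + + n * r                                   ≡⟨ cong₂ _+_ n*r≡sumRows n*r≡sumRows ⟩
    sumRows + sumRows                                   ≡⟨ cong (_+_ sumRows) (sumFin-comm A) ⟩
    sumRows + sumFin (λ b → sumFin (λ c → A c b))       ≡⟨ sym (sumFin-+ (λ b → sumFin (A b)) (λ b → sumFin (λ c → A c b))) ⟩
    sumFin (λ b → sumFin (A b) + sumFin (λ c → A c b))  ≡⟨ sumFin-cong rowSum+colSum ⟩
    sumFin {n} (λ _ → + n - + 1)                        ≡⟨ sumFin-const n (+ n - + 1) ⟩
    + n * (+ n - + 1)                                   ∎
    where
    r sumRows : ℤ
    r = sumFin (A a)
    sumRows = sumFin (λ b → sumFin (A b))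

    n*r≡sumRows : + n * r ≡ sumRows
    n*r≡sumRows = sym (trans (sumFin-cong (λ b → reg b a)) (sumFin-const n r))

    double : ∀ m x → m * (+ 2 * x) ≡ m * x + m * x
    double = solve-∀

  ⊗ˡ-sum : ∀ (Y : Mat n) a b → (A ⊗ Y) a b + (transpose A ⊗ Y) a b ≡ sumFin (λ c → Y c b) - Y a b
  ⊗ˡ-sum Y a b = begin
    (A ⊗ Y) a b + (transpose A ⊗ Y) a b                  ≡⟨ sym (sumFin-+ (λ c → A a c * Y c b) (λ c → A c a * Y c b)) ⟩
    sumFin (λ c → A a c * Y c b + A c a * Y c b)         ≡⟨ sumFin-cong (λ c → sym (*-distribʳ-+ (Y c b) (A a c) (A c a))) ⟩
    sumFin (λ c → (A a c + A c a) * Y c b)               ≡⟨ sumFin-cong (λ c → cong (_* Y c b) (A+Aᵀ≡J-I a c)) ⟩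
    sumFin (λ c → (+ 1 - I a c) * Y c b)                 ≡⟨ sumFin-cong (λ c → expand (I a c) (Y c b)) ⟩
    sumFin (λ c → Y c b - I a c * Y c b)                 ≡⟨ sumFin-- (λ c → Y c b) (λ c → I a c * Y c b) ⟩
    sumFin (λ c → Y c b) - sumFin (λ c → I a c * Y c b)  ≡⟨ cong (_-_ (sumFin (λ c → Y c b))) (sumFin-I-* a (λ c → Y c b)) ⟩
    sumFin (λ c → Y c b) - Y a b                         ∎
    where
    expand : ∀ i y → (+ 1 - i) * y ≡ y - i * y
    expand = solve-∀

  ⊗ʳ-sum : ∀ (Y : Mat n) a b → (Y ⊗ A) a b + (Y ⊗ transpose A) a b ≡ sumFin (Y a) - Y a b
  ⊗ʳ-sum Y a b = begin
    (Y ⊗ A) a b + (Y ⊗ transpose A) a b             ≡⟨ sym (sumFin-+ (λ c → Y a c * A c b) (λ c → Y a c * A b c)) ⟩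
    sumFin (λ c → Y a c * A c b + Y a c * A b c)    ≡⟨ sumFin-cong (λ c → sym (*-distribˡ-+ (Y a c) (A c b) (A b c))) ⟩
    sumFin (λ c → Y a c * (A c b + A b c))          ≡⟨ sumFin-cong (λ c → cong (Y a c *_) (trans (A+Aᵀ≡J-I c b) (cong (+ 1 -_) (I-sym c b)))) ⟩
    sumFin (λ c → Y a c * (+ 1 - I b c))            ≡⟨ sumFin-cong (λ c → expand (I b c) (Y a c)) ⟩
    sumFin (λ c → Y a c - I b c * Y a c)            ≡⟨ sumFin-- (Y a) (λ c → I b c * Y a c) ⟩
    sumFin (Y a) - sumFin (λ c → I b c * Y a c)     ≡⟨ cong (_-_ (sumFin (Y a))) (sumFin-I-* b (Y a)) ⟩
    sumFin (Y a) - Y a b                            ∎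
    where
    expand : ∀ i y → y * (+ 1 - i) ≡ y - i * y
    expand = solve-∀

module RegularTournament {K} {A : Mat (2 ℕ.* K ℕ.+ 1)} (tour : IsTournament A) (reg : IsRegular A) where

  open Tournament tour public

  private
    n : ℕ
    n = 2 ℕ.* K ℕ.+ 1

    n-1≡2K : + n - + 1 ≡ + 2 * + K
    n-1≡2K = trans (cong (_- + 1) (trans (pos-+ (2 ℕ.* K) 1) (cong (_+ + 1) (pos-* 2 K)))) (cancel (+ 2 * + K))
      where
      cancel : ∀ x → x + + 1 - + 1 ≡ x
      cancel = solve-∀

  rowSum : ∀ a → sumFin (A a) ≡ + K
  rowSum a = *-cancelˡ-≡ (+ 2) _ _ (*-cancelˡ-≡ (+ n) _ _ {{ℕ.>-nonZero (ℕ.m≤n+m 1 (2 ℕ.* K))}}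
    (trans (regular⇒rowSum reg a) (cong (+ n *_) n-1≡2K)))

  colSum : ∀ b → sumFin (λ a → A a b) ≡ + K
  colSum b = begin
    c                                ≡⟨ sym (cancel (sumFin (A b)) c) ⟩
    sumFin (A b) + c - sumFin (A b)  ≡⟨ cong₂ _-_ (trans (rowSum+colSum b) n-1≡2K) (rowSum b) ⟩
    + 2 * + K - + K                  ≡⟨ halve (+ K) ⟩
    + K                              ∎
    where
    c : ℤ
    c = sumFin (λ a → A a b)

    cancel : ∀ r c → r + c - r ≡ c
    cancel = solve-∀

    halve : ∀ x → + 2 * x - x ≡ x
    halve = solve-∀

module _ (w m : ℕ) where

  block : Fin (2 ℕ.* w ℕ.* m) → Fin (2 ℕ.* w)
  block = quotient m

  inner : Fin (2 ℕ.* w ℕ.* m) → Fin m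
  inner = remainder {2 ℕ.* w} m

  blockMat-combineʳ : ∀ F x j b → blockMat w m F x (combine j b) ≡ F (block x) j (inner x) b
  blockMat-combineʳ F x j b = cong (λ (j′ , b′) → F (block x) j′ (inner x) b′) (remQuot-combine j b)

  blockMat-combineˡ : ∀ F i a y → blockMat w m F (combine i a) y ≡ F i (block y) a (inner y)
  blockMat-combineˡ F i a y = cong (λ (i′ , a′) → F i′ (block y) a′ (inner y)) (remQuot-combine i a)

  blockMat-rowSum : ∀ F x → sumFin (blockMat w m F x) ≡ sumFin (λ j → sumFin (F (block x) j (inner x)))
  blockMat-rowSum F x = trans (sumFin-combine (2 ℕ.* w) m (blockMat w m F x))
                              (sumFin-cong (λ j → sumFin-cong (blockMat-combineʳ F x j)))

  blockMat-colSum : ∀ F y → sumFin (λ x → blockMat w m F x y) ≡ sumFin (λ i → sumFin (λ a → F i (block y) a (inner y)))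
  blockMat-colSum F y = trans (sumFin-combine (2 ℕ.* w) m (λ x → blockMat w m F x y))
                              (sumFin-cong (λ i → sumFin-cong (λ a → blockMat-combineˡ F i a y)))

  blockMat-⊗ : ∀ F G x y → (blockMat w m F ⊗ blockMat w m G) x y
                         ≡ sumFin (λ l → (F (block x) l ⊗ G l (block y)) (inner x) (inner y))
  blockMat-⊗ F G x y = trans (sumFin-combine (2 ℕ.* w) m (λ z → blockMat w m F x z * blockMat w m G z y))
                             (sumFin-cong (λ l → sumFin-cong (λ c → cong₂ _*_ (blockMat-combineʳ F x l c) (blockMat-combineˡ G l c y))))

-- With t = μ the identity terms cancel, so M² = tI + λM + μ(J − I − M) becomes M² = w (KJ − M).
square⇒IsDSRG : ∀ {N} {M : Mat N} {n d k w : ℕ} → N ≡ n → ZeroOne M → (∀ x → M x x ≡ + 0)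
              → (∀ x → sumFin (M x) ≡ + d) → (∀ y → sumFin (λ x → M x y) ≡ + d)
              → (∀ x y → (M ⊗ M) x y ≡ + w * (+ suc k - M x y))
              → IsDSRG M n d (suc k ℕ.* w) (k ℕ.* w) (suc k ℕ.* w)
square⇒IsDSRG {M = M} {d = d} {k} {w} N≡n zeroOne diagonal rowSum colSum square =
  N≡n , zeroOne , diagonal ,
  (λ x y → trans (square x y) (equation (I x y) (M x y))) ,
  (λ x y → trans (⊗-J M x y) (trans (rowSum x) (sym (*-identityʳ (+ d))))) ,
  (λ x y → trans (J-⊗ M x y) (trans (colSum y) (sym (*-identityʳ (+ d)))))
  where
  ring : ∀ k w i y → w * ((+ 1 + k) - y) ≡ ((+ 1 + k) * w) * i + (k * w) * y + ((+ 1 + k) * w) * (+ 1 - i - y)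
  ring = solve-∀

  equation : ∀ i y → + w * (+ suc k - y)
                   ≡ + (suc k ℕ.* w) * i + + (k ℕ.* w) * y + + (suc k ℕ.* w) * (+ 1 - i - y)
  equation i y = trans (ring (+ k) (+ w) i y)
                       (cong₂ (λ t λ′ → t * i + λ′ * y + t * (+ 1 - i - y)) (sym (pos-* (suc k) w)) (sym (pos-* k w)))

module RegularTournamentBlocks {K} {A : Mat (2 ℕ.* K ℕ.+ 1)} (tour : IsTournament A) (reg : IsRegular A) (w : ℕ) where

  open RegularTournament {K} tour reg

  n : ℕ
  n = 2 ℕ.* K ℕ.+ 1

  oriented : Bool → Mat n
  oriented e = if e then A else transpose A

  oriented-zeroOne : ∀ e → ZeroOne (oriented e)
  oriented-zeroOne true  = proj₁ tour
  oriented-zeroOne false a b = proj₁ tour b a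

  oriented-diagonal : ∀ e a → oriented e a a ≡ + 0
  oriented-diagonal true  = diagonal
  oriented-diagonal false = diagonal

  oriented-rowSum : ∀ e a → sumFin (oriented e a) ≡ + K
  oriented-rowSum true  = rowSum
  oriented-rowSum false = colSum

  oriented-colSum : ∀ e b → sumFin (λ a → oriented e a b) ≡ + K
  oriented-colSum true  = colSum
  oriented-colSum false = rowSum

  blocks-sum : sumFin {2 ℕ.* w} (λ _ → + K) ≡ + (2 ℕ.* K ℕ.* w)
  blocks-sum = trans (sumFin-const (2 ℕ.* w) (+ K)) (trans (sym (pos-* (2 ℕ.* w) K)) (cong +_ (reorder K w)))
    where
    reorder : ∀ K w → 2 ℕ.* w ℕ.* K ≡ 2 ℕ.* K ℕ.* w
    reorder = ℕ-Solver.solve-∀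

  module OrientedBlocks (e : Fin (2 ℕ.* w) → Fin (2 ℕ.* w) → Bool) where

    F : Fin (2 ℕ.* w) → Fin (2 ℕ.* w) → Mat n
    F i j = oriented (e i j)

    M : Mat (2 ℕ.* w ℕ.* n)
    M = blockMat w n F

    M-zeroOne : ZeroOne M
    M-zeroOne x y = oriented-zeroOne (e (block w n x) (block w n y)) (inner w n x) (inner w n y)

    M-diagonal : ∀ x → M x x ≡ + 0
    M-diagonal x = oriented-diagonal (e (block w n x) (block w n x)) (inner w n x)

    M-rowSum : ∀ x → sumFin (M x) ≡ + (2 ℕ.* K ℕ.* w)
    M-rowSum x = trans (blockMat-rowSum w n F x)
                       (trans (sumFin-cong (λ j → oriented-rowSum (e (block w n x) j) (inner w n x))) blocks-sum)

    M-colSum : ∀ y → sumFin (λ x → M x y) ≡ + (2 ℕ.* K ℕ.* w)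
    M-colSum y = trans (blockMat-colSum w n F y)
                       (trans (sumFin-cong (λ i → oriented-colSum (e i (block w n y)) (inner w n y))) blocks-sum)

  order : 2 ℕ.* w ℕ.* n ≡ (4 ℕ.* K ℕ.+ 2) ℕ.* w
  order = arithmetic K w
    where
    arithmetic : ∀ K w → 2 ℕ.* w ℕ.* (2 ℕ.* K ℕ.+ 1) ≡ (4 ℕ.* K ℕ.+ 2) ℕ.* w
    arithmetic = ℕ-Solver.solve-∀

  module B = OrientedBlocks (λ i j → isEven (toℕ j))
  module C = OrientedBlocks (λ i j → isEven (toℕ i))

  B-square : ∀ x y → (B.M ⊗ B.M) x y ≡ + w * (+ K - B.M x y)
  B-square x y = begin
    (B.M ⊗ B.M) x y                                               ≡⟨ blockMat-⊗ w n B.F B.F x y ⟩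
    sumFin {2 ℕ.* w} (λ l → (oriented (isEven (toℕ l)) ⊗ Y) a b)  ≡⟨ sumFin-alternating w (λ e → (oriented e ⊗ Y) a b) ⟩
    + w * ((A ⊗ Y) a b + (transpose A ⊗ Y) a b)                   ≡⟨ cong (+ w *_) (⊗ˡ-sum Y a b) ⟩
    + w * (sumFin {n} (λ c → Y c b) - Y a b)                      ≡⟨ cong (λ s → + w * (s - Y a b)) (oriented-colSum (isEven (toℕ (block w n y))) b) ⟩
    + w * (+ K - Y a b)                                           ∎
    where
    Y : Mat n
    Y = oriented (isEven (toℕ (block w n y)))
    a b : Fin n
    a = inner w n x
    b = inner w n y

  C-square : ∀ x y → (C.M ⊗ C.M) x y ≡ + w * (+ K - C.M x y)
  C-square x y = begin
    (C.M ⊗ C.M) x y                                               ≡⟨ blockMat-⊗ w n C.F C.F x y ⟩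
    sumFin {2 ℕ.* w} (λ l → (X ⊗ oriented (isEven (toℕ l))) a b)  ≡⟨ sumFin-alternating w (λ e → (X ⊗ oriented e) a b) ⟩
    + w * ((X ⊗ A) a b + (X ⊗ transpose A) a b)                   ≡⟨ cong (+ w *_) (⊗ʳ-sum X a b) ⟩
    + w * (sumFin (X a) - X a b)                                  ≡⟨ cong (λ s → + w * (s - X a b)) (oriented-rowSum (isEven (toℕ (block w n x))) a) ⟩
    + w * (+ K - X a b)                                           ∎
    where
    X : Mat n
    X = oriented (isEven (toℕ (block w n x)))
    a b : Fin n
    a = inner w n x
    b = inner w n y

lemma4 : (k w : ℕ) → (A : Mat (2 ℕ.* suc k ℕ.+ 1)) → IsTournament A → IsRegular A
       → IsDSRG (matB (suc w) (2 ℕ.* suc k ℕ.+ 1) A) ((4 ℕ.* suc k ℕ.+ 2) ℕ.* suc w) (2 ℕ.* suc k ℕ.* suc w) (suc k ℕ.* suc w) (k ℕ.* suc w) (suc k ℕ.* suc w)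
         × IsDSRG (matC (suc w) (2 ℕ.* suc k ℕ.+ 1) A) ((4 ℕ.* suc k ℕ.+ 2) ℕ.* suc w) (2 ℕ.* suc k ℕ.* suc w) (suc k ℕ.* suc w) (k ℕ.* suc w) (suc k ℕ.* suc w)
lemma4 k w A tour reg =
  square⇒IsDSRG order B.M-zeroOne B.M-diagonal B.M-rowSum B.M-colSum B-square ,
  square⇒IsDSRG order C.M-zeroOne C.M-diagonal C.M-rowSum C.M-colSum C-square
  where
  open RegularTournamentBlocks {suc k} tour reg (suc w)
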